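{- Let $R$ be a Dedekind domain and let $I$ and $J$ be relatively prime (i.e. $I+J=R$) nonzero ideals of $R$ such that $R/I$ and $R/J$ are finite. Then $\mathscr{S}_r(R/IJ)=\mathscr{S}_r(R/I)\,\mathscr{S}_r(R/J)$ for all positive integers $r$.
   Context: For an ideal $I$ of a Dedekind domain $R$ with $R/I$ finite and a positive integer $r$, define $L_r(R/I)=\{a+I\in R/I : a+i+I\in U(R/I)\text{ for all } i\in\{0,1,\ldots,r-1\}\}$, where $U(\cdot)$ denotes the group of units and an integer $i$ is viewed as the element $1+1+\cdots+1$ ($i$ times) of $R$. Set $\mathscr{S}_r(R/I)=|L_r(R/I)|$. -}

module Defs where

open import Level using (Level; _⊔_) renaming (suc to lsuc)
open import Algebra.Bundles using (CommutativeRing)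
open import Data.Nat as ℕ using (ℕ; zero; suc)
open import Data.Fin as F using (Fin; toℕ)
open import Data.List using (List; []; _∷_; zipWith)
open import Data.List.Relation.Unary.All using (All)
open import Data.Product using (Σ; ∃; _×_; _,_; proj₁; proj₂)
open import Data.Sum using (_⊎_)
open import Data.Unit.Polymorphic using (⊤)
open import Relation.Nullary using (¬_)
open import Relation.Binary.PropositionalEquality using (_≡_)

module _ {c ℓ : Level} (R : CommutativeRing c ℓ) where
  open CommutativeRing R using (_≈_; _+_; _*_; -_; _-_; 0#; 1#) renaming (Carrier to A)

  record IsIdeal (I : A → Set (c ⊔ ℓ)) : Set (c ⊔ ℓ) where
    field
      resp     : ∀ {x y} → x ≈ y → I x → I y
      zero∈    : I 0#
      +-closed : ∀ {x y} → I x → I y → I (x + y)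
      *-closed : ∀ r {x} → I x → I (r * x)

  record Ideal : Set (lsuc (c ⊔ ℓ)) where
    field
      pred    : A → Set (c ⊔ ℓ)
      isIdeal : IsIdeal pred

  _∈_ : A → Ideal → Set (c ⊔ ℓ)
  x ∈ I = Ideal.pred I x

  NonzeroIdeal : Ideal → Set (c ⊔ ℓ)
  NonzeroIdeal I = ∃ λ x → x ∈ I × ¬ (x ≈ 0#)

  ProperIdeal : Ideal → Set (c ⊔ ℓ)
  ProperIdeal I = ¬ (1# ∈ I)

  Comaximal : Ideal → Ideal → Set (c ⊔ ℓ)
  Comaximal I J = ∀ x → ∃ λ a → ∃ λ b → a ∈ I × b ∈ J × (x ≈ a + b)

  sumProd : List (A × A) → A
  sumProd []            = 0#
  sumProd ((a , b) ∷ ps) = a * b + sumProd ps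

  ProdIdeal : Ideal → Ideal → A → Set (c ⊔ ℓ)
  ProdIdeal I J x = ∃ λ (ps : List (A × A)) →
    All (λ p → proj₁ p ∈ I × proj₂ p ∈ J) ps × (x ≈ sumProd ps)

  _≡[_]_ : A → (A → Set (c ⊔ ℓ)) → A → Set (c ⊔ ℓ)
  x ≡[ I ] y = I (x - y)

  IsUnitMod : (A → Set (c ⊔ ℓ)) → A → Set (c ⊔ ℓ)
  IsUnitMod I a = ∃ λ b → (a * b) ≡[ I ] 1#

  ι : ℕ → A
  ι zero    = 0#
  ι (suc n) = ι n + 1#

  L : ℕ → (A → Set (c ⊔ ℓ)) → A → Set (c ⊔ ℓ)
  L r I a = ∀ (i : ℕ) → i ℕ.< r → IsUnitMod I (a + ι i)

  HasCardMod : ∀ {p} → (A → Set (c ⊔ ℓ)) → (A → Set p) → ℕ → Set (c ⊔ ℓ ⊔ p)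
  HasCardMod I P m = Σ (Fin m → A) λ f →
      (∀ k → P (f k))
    × (∀ k l → f k ≡[ I ] f l → k ≡ l)
    × (∀ a → P a → ∃ λ k → f k ≡[ I ] a)

  FiniteQuotient : (A → Set (c ⊔ ℓ)) → Set (c ⊔ ℓ)
  FiniteQuotient I = ∃ λ n → HasCardMod I (λ _ → ⊤ {c ⊔ ℓ}) n

  IsIntegralDomain : Set (c ⊔ ℓ)
  IsIntegralDomain = ¬ (1# ≈ 0#) × (∀ a b → a * b ≈ 0# → (a ≈ 0#) ⊎ (b ≈ 0#))

  LinComb : List A → A → Set (c ⊔ ℓ)
  LinComb gs x = ∃ λ (cs : List A) → x ≈ sumProd (zipWith _,_ cs gs)

  IsNoetherian : Set (lsuc (c ⊔ ℓ))
  IsNoetherian = ∀ (I : Ideal) → ∃ λ (gs : List A) →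
    All (_∈ I) gs × (∀ x → x ∈ I → LinComb gs x)

  IsPrimeIdeal : Ideal → Set (c ⊔ ℓ)
  IsPrimeIdeal P = ProperIdeal P × (∀ a b → (a * b) ∈ P → (a ∈ P) ⊎ (b ∈ P))

  IsMaximalIdeal : Ideal → Set (lsuc (c ⊔ ℓ))
  IsMaximalIdeal M = ProperIdeal M ×
    (∀ (Q : Ideal) → (∀ x → x ∈ M → x ∈ Q) → (∀ x → x ∈ Q → x ∈ M) ⊎ (1# ∈ Q))

  pow : A → ℕ → A
  pow a zero    = 1#
  pow a (suc n) = a * pow a n

  sumFin : ∀ n → (Fin n → A) → A
  sumFin zero    f = 0#
  sumFin (suc n) f = f F.zero + sumFin n (λ k → f (F.suc k))

  -- a/b (b ≠ 0) is a root of the monic polynomial X^n + Σ_{k<n} cs k X^k,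
  -- written after clearing denominators:
  -- a^n + Σ_{k<n} cs k a^k b^(n-k) = 0
  MonicRootFrac : A → A → Set (c ⊔ ℓ)
  MonicRootFrac a b = ∃ λ n → ∃ λ (cs : Fin n → A) →
    pow a n + sumFin n (λ k → cs k * pow a (toℕ k) * pow b (n ℕ.∸ toℕ k)) ≈ 0#

  -- integrally closed in its field of fractions: an element a/b of the
  -- fraction field integral over R already lies in R, i.e. b divides a
  IsIntegrallyClosed : Set (c ⊔ ℓ)
  IsIntegrallyClosed = ∀ a b → ¬ (b ≈ 0#) → MonicRootFrac a b → ∃ λ q → a ≈ q * b

  record IsDedekindDomain : Set (lsuc (c ⊔ ℓ)) where
    field
      integralDomain   : IsIntegralDomain
      noetherian       : IsNoetherian
      integrallyClosed : IsIntegrallyClosed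
      primeMaximal     : ∀ (P : Ideal) → NonzeroIdeal P → IsPrimeIdeal P → IsMaximalIdeal P

-- The Chinese remainder theorem: since I + J = R, the map a + IJ ↦ (a + I, a + J) is a
-- bijection R/IJ → R/I × R/J, and a class mod IJ is a unit iff both of its images are.
-- Hence a + IJ lies in L_r(R/IJ) iff a + I ∈ L_r(R/I) and a + J ∈ L_r(R/J), and the bijection
-- restricts to L_r(R/IJ) ≅ L_r(R/I) × L_r(R/J).
module Submission where

open import Defs
open import Level using (Level; _⊔_)
open import Algebra.Bundles using (CommutativeRing)
open import Data.Nat using (ℕ; _≤_; _*_)
open import Data.Fin using (Fin)
open import Data.Fin.Properties using (*↔×)
open import Data.Fin.Permutation using (↔⇒≡)
open import Data.List using ([]; _∷_)
open import Data.List.Relation.Unary.All using (All; []; _∷_)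
open import Data.Product using (_×_; _,_; proj₁; proj₂)
open import Function.Bundles using (mk↔ₛ′)
open import Function.Properties.Inverse using (↔-trans; ↔-sym)
open import Relation.Binary.PropositionalEquality using (_≡_; cong₂)
import Algebra.Properties.Ring as RingProperties
import Algebra.Properties.AbelianGroup as AbelianGroupProperties
import Algebra.Properties.CommutativeSemigroup as CommutativeSemigroupProperties
import Relation.Binary.Reasoning.Setoid as SetoidReasoning

module RingIdentities {c ℓ : Level} (R : CommutativeRing c ℓ) where
  open CommutativeRing R renaming (_*_ to _·_)
  open RingProperties ring using ([y-z]x≈yx-zx)
  open AbelianGroupProperties +-abelianGroup using (⁻¹-∙-comm)
  open CommutativeSemigroupProperties +-commutativeSemigroup using (interchange)
  open SetoidReasoning setoid

  x-z≈[x-y]+[y-z] : ∀ x y z → x - z ≈ (x - y) + (y - z)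
  x-z≈[x-y]+[y-z] x y z = sym (begin
    (x - y) + (y - z)      ≈⟨ +-assoc x (- y) (y - z) ⟩
    x + (- y + (y - z))    ≈⟨ +-congˡ (sym (+-assoc (- y) y (- z))) ⟩
    x + ((- y + y) - z)    ≈⟨ +-congˡ (+-congʳ (-‿inverseˡ y)) ⟩
    x + (0# - z)           ≈⟨ +-congˡ (+-identityˡ (- z)) ⟩
    x - z                  ∎)

  [x+y]-[z+w]≈[x-z]+[y-w] : ∀ x y z w → (x + y) - (z + w) ≈ (x - z) + (y - w)
  [x+y]-[z+w]≈[x-z]+[y-w] x y z w = begin
    (x + y) - (z + w)      ≈⟨ +-congˡ (sym (⁻¹-∙-comm z w)) ⟩
    (x + y) + (- z + - w)  ≈⟨ interchange x y (- z) (- w) ⟩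
    (x - z) + (y - w)      ∎

  [x+z]-[y+z]≈x-y : ∀ x y z → (x + z) - (y + z) ≈ x - y
  [x+z]-[y+z]≈x-y x y z = begin
    (x + z) - (y + z)      ≈⟨ [x+y]-[z+w]≈[x-z]+[y-w] x z y z ⟩
    (x - y) + (z - z)      ≈⟨ +-congˡ (-‿inverseʳ z) ⟩
    (x - y) + 0#           ≈⟨ +-identityʳ (x - y) ⟩
    x - y                  ∎

  [xe′+ye]-x≈[y-x]e : ∀ {e e′} → 1# ≈ e + e′ → ∀ x y → (x · e′ + y · e) - x ≈ (y - x) · e
  [xe′+ye]-x≈[y-x]e {e} {e′} 1≈e+e′ x y = begin
    (x · e′ + y · e) - x                 ≈⟨ +-congˡ (-‿cong x≈xe′+xe) ⟩
    (x · e′ + y · e) - (x · e′ + x · e)  ≈⟨ [x+y]-[z+w]≈[x-z]+[y-w] _ _ _ _ ⟩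
    (x · e′ - x · e′) + (y · e - x · e)  ≈⟨ +-congʳ (-‿inverseʳ (x · e′)) ⟩
    0# + (y · e - x · e)                 ≈⟨ +-identityˡ _ ⟩
    y · e - x · e                        ≈⟨ [y-z]x≈yx-zx e y x ⟨
    (y - x) · e                          ∎
    where
    x≈xe′+xe : x ≈ x · e′ + x · e
    x≈xe′+xe = begin
      x                ≈⟨ *-identityʳ x ⟨
      x · 1#           ≈⟨ *-congˡ 1≈e+e′ ⟩
      x · (e + e′)     ≈⟨ distribˡ x e e′ ⟩
      x · e + x · e′   ≈⟨ +-comm _ _ ⟩
      x · e′ + x · e   ∎

module Mod {c ℓ : Level} (R : CommutativeRing c ℓ) where
  open CommutativeRing R using () renaming (Carrier to A)

  infix 4 _≡_mod_
  _≡_mod_ : A → A → (A → Set (c ⊔ ℓ)) → Set (c ⊔ ℓ)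
  _≡_mod_ x y P = _≡[_]_ R x P y

module Congruence {c ℓ : Level} (R : CommutativeRing c ℓ) (I : Ideal R) where
  open CommutativeRing R renaming (Carrier to A; _*_ to _·_)
  open Mod R
  open RingProperties ring using (-1*x≈-x; x[y-z]≈xy-xz; [y-z]x≈yx-zx)
  open AbelianGroupProperties +-abelianGroup using (⁻¹-anti-homo‿-)
  open RingIdentities R
  open IsIdeal (Ideal.isIdeal I)

  private
    pI = Ideal.pred I

  ≡-sym : ∀ {x y} → x ≡ y mod pI → y ≡ x mod pI
  ≡-sym {x} {y} x≡y =
    resp (trans (-1*x≈-x (x - y)) (⁻¹-anti-homo‿- x y)) (*-closed (- 1#) x≡y)

  ≡-trans : ∀ {x y z} → x ≡ y mod pI → y ≡ z mod pI → x ≡ z mod pI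
  ≡-trans {x} {y} {z} x≡y y≡z = resp (sym (x-z≈[x-y]+[y-z] x y z)) (+-closed x≡y y≡z)

  ≡-*ˡ : ∀ u {x y} → x ≡ y mod pI → u · x ≡ u · y mod pI
  ≡-*ˡ u {x} {y} x≡y = resp (x[y-z]≈xy-xz u x y) (*-closed u x≡y)

  ≡-*ʳ : ∀ u {x y} → x ≡ y mod pI → x · u ≡ y · u mod pI
  ≡-*ʳ u {x} {y} x≡y = resp (trans (*-comm u (x - y)) ([y-z]x≈yx-zx u x y)) (*-closed u x≡y)

  ≡-+ʳ : ∀ u {x y} → x ≡ y mod pI → x + u ≡ y + u mod pI
  ≡-+ʳ u {x} {y} = resp (sym ([x+z]-[y+z]≈x-y x y u))

  IsUnitMod-resp : ∀ {u u′} → u′ ≡ u mod pI → IsUnitMod R pI u → IsUnitMod R pI u′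
  IsUnitMod-resp u′≡u (v , uv≡1) = v , ≡-trans (≡-*ʳ v u′≡u) uv≡1

  L-resp : ∀ {r a a′} → a′ ≡ a mod pI → L R r pI a → L R r pI a′
  L-resp a′≡a a∈L i i<r = IsUnitMod-resp (≡-+ʳ (ι R i) a′≡a) (a∈L i i<r)

  module Enumeration {p} {P : A → Set p} {m : ℕ} (card : HasCardMod R pI P m) where
    private
      f = proj₁ card

    index : ∀ a → P a → Fin m
    index a Pa = proj₁ (proj₂ (proj₂ (proj₂ card)) a Pa)

    index-≡ : ∀ {a} (Pa : P a) → f (index a Pa) ≡ a mod pI
    index-≡ {a} Pa = proj₂ (proj₂ (proj₂ (proj₂ card)) a Pa)

    index-unique : ∀ {a} (Pa : P a) k → f k ≡ a mod pI → index a Pa ≡ k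
    index-unique Pa k fk≡a =
      proj₁ (proj₂ (proj₂ card)) _ k (≡-trans (index-≡ Pa) (≡-sym fk≡a))

module ChineseRemainder {c ℓ : Level} (R : CommutativeRing c ℓ)
                        (I J : Ideal R) (I+J≡R : Comaximal R I J) where
  open CommutativeRing R renaming (Carrier to A; _*_ to _·_)
  open Mod R
  open RingIdentities R
  open SetoidReasoning setoid
  module I = IsIdeal (Ideal.isIdeal I)
  module J = IsIdeal (Ideal.isIdeal J)
  module I≡ = Congruence R I
  module J≡ = Congruence R J

  private
    pI = Ideal.pred I
    pJ = Ideal.pred J
    pIJ = ProdIdeal R I J

    e e′ : A
    e = proj₁ (I+J≡R 1#)
    e′ = proj₁ (proj₂ (I+J≡R 1#))

    e∈I : pI e
    e∈I = proj₁ (proj₂ (proj₂ (I+J≡R 1#)))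

    e′∈J : pJ e′
    e′∈J = proj₁ (proj₂ (proj₂ (proj₂ (I+J≡R 1#))))

    1≈e+e′ : 1# ≈ e + e′
    1≈e+e′ = proj₂ (proj₂ (proj₂ (proj₂ (I+J≡R 1#))))

  -- e ≡ 0 and e′ ≡ 1 mod I, while e ≡ 1 and e′ ≡ 0 mod J.
  glue : A → A → A
  glue x y = x · e′ + y · e

  glue-≡ˡ : ∀ x y → glue x y ≡ x mod pI
  glue-≡ˡ x y = I.resp (sym ([xe′+ye]-x≈[y-x]e 1≈e+e′ x y)) (I.*-closed (y - x) e∈I)

  glue-≡ʳ : ∀ x y → glue x y ≡ y mod pJ
  glue-≡ʳ x y = J.resp eq (J.*-closed (x - y) e′∈J)
    where
    eq : (x - y) · e′ ≈ glue x y - y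
    eq = begin
      (x - y) · e′          ≈⟨ [xe′+ye]-x≈[y-x]e (trans 1≈e+e′ (+-comm e e′)) y x ⟨
      (y · e + x · e′) - y  ≈⟨ +-congʳ (+-comm (y · e) (x · e′)) ⟩
      glue x y - y          ∎

  IJ⊆I : ∀ {x} → pIJ x → pI x
  IJ⊆I (ps , ps∈I×J , x≈Σps) = I.resp (sym x≈Σps) (sum∈I ps ps∈I×J)
    where
    sum∈I : ∀ ps → All (λ p → pI (proj₁ p) × pJ (proj₂ p)) ps → pI (sumProd R ps)
    sum∈I [] [] = I.zero∈
    sum∈I ((a , b) ∷ ps) ((a∈I , _) ∷ rest) =
      I.+-closed (I.resp (*-comm b a) (I.*-closed b a∈I)) (sum∈I ps rest)

  IJ⊆J : ∀ {x} → pIJ x → pJ x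
  IJ⊆J (ps , ps∈I×J , x≈Σps) = J.resp (sym x≈Σps) (sum∈J ps ps∈I×J)
    where
    sum∈J : ∀ ps → All (λ p → pI (proj₁ p) × pJ (proj₂ p)) ps → pJ (sumProd R ps)
    sum∈J [] [] = J.zero∈
    sum∈J ((a , b) ∷ ps) ((_ , b∈J) ∷ rest) = J.+-closed (J.*-closed a b∈J) (sum∈J ps rest)

  I∩J⊆IJ : ∀ {d} → pI d → pJ d → pIJ d
  I∩J⊆IJ {d} d∈I d∈J = ((e , d) ∷ (d , e′) ∷ []) , ((e∈I , d∈J) ∷ (d∈I , e′∈J) ∷ []) , eq
    where
    eq : d ≈ e · d + (d · e′ + 0#)
    eq = begin
      d                      ≈⟨ *-identityʳ d ⟨
      d · 1#                 ≈⟨ *-congˡ 1≈e+e′ ⟩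
      d · (e + e′)           ≈⟨ distribˡ d e e′ ⟩
      d · e + d · e′         ≈⟨ +-cong (*-comm e d) (+-identityʳ (d · e′)) ⟨
      e · d + (d · e′ + 0#)  ∎

  IJ : Ideal R
  IJ = record
    { pred    = pIJ
    ; isIdeal = record
      { resp     = λ x≈y x∈IJ → I∩J⊆IJ (I.resp x≈y (IJ⊆I x∈IJ)) (J.resp x≈y (IJ⊆J x∈IJ))
      ; zero∈    = I∩J⊆IJ I.zero∈ J.zero∈
      ; +-closed = λ x∈IJ y∈IJ → I∩J⊆IJ (I.+-closed (IJ⊆I x∈IJ) (IJ⊆I y∈IJ))
                                        (J.+-closed (IJ⊆J x∈IJ) (IJ⊆J y∈IJ))
      ; *-closed = λ r x∈IJ → I∩J⊆IJ (I.*-closed r (IJ⊆I x∈IJ)) (J.*-closed r (IJ⊆J x∈IJ))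
      }
    }

  IsUnitMod-IJ : ∀ {u} → IsUnitMod R pI u → IsUnitMod R pJ u → IsUnitMod R pIJ u
  IsUnitMod-IJ {u} (v , uv≡1) (w , uw≡1) = glue v w ,
    I∩J⊆IJ (I≡.≡-trans (I≡.≡-*ˡ u (glue-≡ˡ v w)) uv≡1)
           (J≡.≡-trans (J≡.≡-*ˡ u (glue-≡ʳ v w)) uw≡1)

  L-IJ⇒L-I : ∀ {r a} → L R r pIJ a → L R r pI a
  L-IJ⇒L-I a∈L i i<r = proj₁ (a∈L i i<r) , IJ⊆I (proj₂ (a∈L i i<r))

  L-IJ⇒L-J : ∀ {r a} → L R r pIJ a → L R r pJ a
  L-IJ⇒L-J a∈L i i<r = proj₁ (a∈L i i<r) , IJ⊆J (proj₂ (a∈L i i<r))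

  L-I×L-J⇒L-IJ : ∀ {r a} → L R r pI a → L R r pJ a → L R r pIJ a
  L-I×L-J⇒L-IJ a∈Lᴵ a∈Lᴶ i i<r = IsUnitMod-IJ (a∈Lᴵ i i<r) (a∈Lᴶ i i<r)

  HasCardMod-IJ : ∀ {p} {P Q S : A → Set p} {m₁ m₂ m₃} →
    (∀ {a a′} → a′ ≡ a mod pI → P a → P a′) →
    (∀ {a a′} → a′ ≡ a mod pJ → Q a → Q a′) →
    (∀ {a} → S a → P a) → (∀ {a} → S a → Q a) → (∀ {a} → P a → Q a → S a) →
    HasCardMod R pI P m₁ → HasCardMod R pJ Q m₂ → HasCardMod R pIJ S m₃ →
    m₃ ≡ m₁ * m₂
  HasCardMod-IJ {S = S} {m₁} {m₂} {m₃} P-resp Q-resp S⇒P S⇒Q P×Q⇒S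
                card₁@(f₁ , f₁∈P , _) card₂@(f₂ , f₂∈Q , _) card₃@(f₃ , f₃∈S , _) =
    ↔⇒≡ (↔-trans (mk↔ₛ′ ψ φ ψ∘φ φ∘ψ) (↔-sym *↔×))
    where
    module E₁ = I≡.Enumeration card₁
    module E₂ = J≡.Enumeration card₂
    module E₃ = Congruence.Enumeration R IJ card₃

    glued : Fin m₁ → Fin m₂ → A
    glued k l = glue (f₁ k) (f₂ l)

    glued∈S : ∀ k l → S (glued k l)
    glued∈S k l = P×Q⇒S (P-resp (glue-≡ˡ (f₁ k) (f₂ l)) (f₁∈P k))
                        (Q-resp (glue-≡ʳ (f₁ k) (f₂ l)) (f₂∈Q l))

    φ : Fin m₁ × Fin m₂ → Fin m₃
    φ (k , l) = E₃.index (glued k l) (glued∈S k l)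

    ψ : Fin m₃ → Fin m₁ × Fin m₂
    ψ k = E₁.index (f₃ k) (S⇒P (f₃∈S k)) , E₂.index (f₃ k) (S⇒Q (f₃∈S k))

    ψ∘φ : ∀ kl → ψ (φ kl) ≡ kl
    ψ∘φ (k , l) = cong₂ _,_
      (E₁.index-unique _ k (I≡.≡-sym (I≡.≡-trans (IJ⊆I glued≡) (glue-≡ˡ (f₁ k) (f₂ l)))))
      (E₂.index-unique _ l (J≡.≡-sym (J≡.≡-trans (IJ⊆J glued≡) (glue-≡ʳ (f₁ k) (f₂ l)))))
      where
      glued≡ = E₃.index-≡ (glued∈S k l)

    φ∘ψ : ∀ k → φ (ψ k) ≡ k
    φ∘ψ k = E₃.index-unique _ k (I∩J⊆IJ
      (I≡.≡-sym (I≡.≡-trans (glue-≡ˡ (f₁ k₁) (f₂ k₂)) (E₁.index-≡ (S⇒P (f₃∈S k)))))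
      (J≡.≡-sym (J≡.≡-trans (glue-≡ʳ (f₁ k₁) (f₂ k₂)) (E₂.index-≡ (S⇒Q (f₃∈S k))))))
      where
      k₁ = proj₁ (ψ k)
      k₂ = proj₂ (ψ k)

theorem2p1 : ∀ {c ℓ : Level} (R : CommutativeRing c ℓ) → IsDedekindDomain R →
    (I J : Ideal R) → NonzeroIdeal R I → NonzeroIdeal R J → Comaximal R I J →
    FiniteQuotient R (Ideal.pred I) → FiniteQuotient R (Ideal.pred J) →
    ∀ (r : ℕ) → 1 ≤ r → ∀ (m₁ m₂ m₃ : ℕ) →
    HasCardMod R (Ideal.pred I) (L R r (Ideal.pred I)) m₁ →
    HasCardMod R (Ideal.pred J) (L R r (Ideal.pred J)) m₂ →
    HasCardMod R (ProdIdeal R I J) (L R r (ProdIdeal R I J)) m₃ →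
    m₃ ≡ m₁ * m₂
theorem2p1 R _ I J _ _ I+J≡R _ _ r _ m₁ m₂ m₃ =
  HasCardMod-IJ (Congruence.L-resp R I) (Congruence.L-resp R J)
                L-IJ⇒L-I L-IJ⇒L-J L-I×L-J⇒L-IJ
  where open ChineseRemainder R I J I+J≡R
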